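{- Let $\mathcal E$ be an exchangeability system for a noncommutative probability space $(\mathcal A,\phi)$, let $\mathcal B,\mathcal C\subseteq\mathcal A$ be $\mathcal E$-independent subalgebras, let $X_1,\dots,X_n\in\mathcal B\cup\mathcal C$ and $\pi\in\Pi_n$. If some block of $\pi$ contains indices $i$ and $j$ with $X_i\in\mathcal B$ and $X_j\in\mathcal C$, then $K_\pi(X_1,\dots,X_n)=0$.
   Context: A noncommutative probability space is a pair $(\mathcal A,\phi)$ of a complex unital algebra $\mathcal A$ and a unital linear functional $\phi$. An exchangeability system $\mathcal E$ for $(\mathcal A,\phi)$ consists of a noncommutative probability space $(\mathcal U,\tilde\phi)$ and embeddings (injective unital homomorphisms) $\iota_k:\mathcal A\to\mathcal U$, $k\in\mathbb N$, with $\tilde\phi\circ\iota_k=\phi$; write $X^{(k)}=\iota_k(X)$. It is required that for all $n$, all $X_1,\dots,X_n\in\mathcal A$, all indices $i_1,\dots,i_n\in\mathbb N$ and every permutation $\sigma$ of $\mathbb N$: $\tilde\phi(X_1^{(i_1)}\cdots X_n^{(i_n)})=\tilde\phi(X_1^{(\sigma(i_1))}\cdots X_n^{(\sigma(i_n))})$. Thus this value depends only on the kernel of $j\mapsto i_j$ (the partition of $[n]$ into level sets); for $\sigma\in\Pi_n$ denote it $\phi_\sigma(X_1,\dots,X_n)$. $\Pi_n$ is the lattice of set partitions of $[n]$ under refinement and $\mu$ its Möbius function; the partitioned cumulant is $K_\pi(X_1,\dots,X_n)=\sum_{\sigma\le\pi}\phi_\sigma(X_1,\dots,X_n)\mu(\sigma,\pi)$.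 Subalgebras $\mathcal B,\mathcal C$ are $\mathcal E$-independent if for all $X_1,\dots,X_n\in\mathcal B\cup\mathcal C$ and disjoint $I,J$ with $I\cup J=[n]$, $X_i\in\mathcal B$ ($i\in I$), $X_i\in\mathcal C$ ($i\in J$), one has $\phi_\pi(X_1,\dots,X_n)=\phi_{\pi'}(X_1,\dots,X_n)$ whenever $\pi|_I=\pi'|_I$ and $\pi|_J=\pi'|_J$. -}

module Defs where

open import Level using (Level; _⊔_) renaming (suc to lsuc)
open import Algebra.Bundles using (CommutativeRing)
open import Algebra.Structures using (IsRing)
open import Data.Nat as ℕ using (ℕ; zero; suc)
open import Data.Nat.Properties using () renaming (_≟_ to _≟ℕ_)
open import Data.Bool using (Bool; true; false; if_then_else_; _∧_; not)
open import Data.Fin using (Fin; zero; suc)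
open import Data.Vec as Vec using (Vec; []; _∷_; _∷ʳ_; lookup)
open import Data.Vec.Properties using (≡-dec)
open import Data.List as List using (List; []; _∷_; concatMap; filter; foldr; upTo; length; allFin)
open import Data.Product using (Σ; _×_; _,_)
open import Function using (_∘_)
open import Function.Bundles using (_↔_; Inverse)
open import Relation.Nullary.Decidable using (⌊_⌋; T?)
open import Data.List.Membership.Propositional using (_∈_; mapWith∈)
open import Relation.Binary.PropositionalEquality using (_≡_; _≢_)

private
  variable
    c ℓ a ℓa b ℓb : Level

-- Scalars: a commutative ring R (stands in for ℂ)

record UnitalAlgebra (R : CommutativeRing c ℓ) (a ℓa : Level) : Set (c ⊔ ℓ ⊔ lsuc (a ⊔ ℓa)) where
  private module R = CommutativeRing R
  infixl 7 _*_
  infixr 7 _·_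
  infixl 6 _+_
  infix 4 _≈_
  field
    Carrier : Set a
    _≈_     : Carrier → Carrier → Set ℓa
    _+_     : Carrier → Carrier → Carrier
    _*_     : Carrier → Carrier → Carrier
    -_      : Carrier → Carrier
    0a      : Carrier
    1a      : Carrier
    isRing  : IsRing _≈_ _+_ _*_ -_ 0a 1a
    _·_     : R.Carrier → Carrier → Carrier
    ·-cong  : ∀ {r s x y} → r R.≈ s → x ≈ y → r · x ≈ s · y
    ·-distribˡ : ∀ r x y → r · (x + y) ≈ r · x + r · y
    ·-distribʳ : ∀ r s x → (r R.+ s) · x ≈ r · x + s · x
    ·-assoc    : ∀ r s x → (r R.* s) · x ≈ r · (s · x)
    ·-identity : ∀ x → R.1# · x ≈ x
    ·-*-assocˡ : ∀ r x y → (r · x) * y ≈ r · (x * y)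
    ·-*-assocʳ : ∀ r x y → x * (r · y) ≈ r · (x * y)
  open IsRing isRing public

record Embedding {R : CommutativeRing c ℓ}
                 (A : UnitalAlgebra R a ℓa) (B : UnitalAlgebra R b ℓb)
                 : Set (c ⊔ a ⊔ ℓa ⊔ b ⊔ ℓb) where
  private
    module A = UnitalAlgebra A
    module B = UnitalAlgebra B
  field
    ⟦_⟧       : A.Carrier → B.Carrier
    cong      : ∀ {x y} → x A.≈ y → ⟦ x ⟧ B.≈ ⟦ y ⟧
    +-homo    : ∀ x y → ⟦ x A.+ y ⟧ B.≈ ⟦ x ⟧ B.+ ⟦ y ⟧
    ·-homo    : ∀ r x → ⟦ r A.· x ⟧ B.≈ r B.· ⟦ x ⟧
    *-homo    : ∀ x y → ⟦ x A.* y ⟧ B.≈ ⟦ x ⟧ B.* ⟦ y ⟧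
    1-homo    : ⟦ A.1a ⟧ B.≈ B.1a
    injective : ∀ {x y} → ⟦ x ⟧ B.≈ ⟦ y ⟧ → x A.≈ y

record NCPS (R : CommutativeRing c ℓ) (a ℓa : Level) : Set (c ⊔ ℓ ⊔ lsuc (a ⊔ ℓa)) where
  private module R = CommutativeRing R
  field
    alg    : UnitalAlgebra R a ℓa
  open UnitalAlgebra alg public
  field
    φ        : Carrier → R.Carrier
    φ-cong   : ∀ {x y} → x ≈ y → φ x R.≈ φ y
    φ-+      : ∀ x y → φ (x + y) R.≈ φ x R.+ φ y
    φ-·      : ∀ r x → φ (r · x) R.≈ r R.* φ x
    φ-unital : φ 1a R.≈ R.1#

prod : {R : CommutativeRing c ℓ} (U : UnitalAlgebra R a ℓa) {n : ℕ} →
       (Fin n → UnitalAlgebra.Carrier U) → UnitalAlgebra.Carrier U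
prod U {zero}  f = UnitalAlgebra.1a U
prod U {suc n} f = UnitalAlgebra._*_ U (f zero) (prod U (f ∘ suc))

record ExchangeabilitySystem {R : CommutativeRing c ℓ} (P : NCPS R a ℓa) (u ℓu : Level)
       : Set (c ⊔ ℓ ⊔ a ⊔ ℓa ⊔ lsuc (u ⊔ ℓu)) where
  private
    module R = CommutativeRing R
    module P = NCPS P
  field
    𝒰      : NCPS R u ℓu
  private module U = NCPS 𝒰
  field
    ι        : ℕ → Embedding P.alg U.alg
  _⁽_⁾ : P.Carrier → ℕ → U.Carrier
  X ⁽ k ⁾ = Embedding.⟦_⟧ (ι k) X
  field
    ι-state  : ∀ k X → U.φ (X ⁽ k ⁾) R.≈ P.φ X
    exchangeable : ∀ (n : ℕ) (X : Fin n → P.Carrier) (i : Fin n → ℕ) (σ : ℕ ↔ ℕ) →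
      U.φ (prod U.alg (λ m → X m ⁽ i m ⁾))
        R.≈ U.φ (prod U.alg (λ m → X m ⁽ Inverse.to σ (i m) ⁾))

-- Set partitions of [n], encoded as restricted growth strings:
-- label vector v with v₀ = 0 and vₖ ≤ 1 + max(v₀..vₖ₋₁); i and j are in
-- the same block iff vᵢ ≡ vⱼ.  rgs n lists every partition of [n] exactly once.

-- all RGS of length n, paired with their number of blocks
rgs′ : (n : ℕ) → List (Vec ℕ n × ℕ)
rgs′ zero    = ([] , 0) ∷ []
rgs′ (suc n) = concatMap ext (rgs′ n)
  where
  ext : Vec ℕ n × ℕ → List (Vec ℕ (suc n) × ℕ)
  ext (v , b) = List.map (λ k → (v ∷ʳ k , (if ⌊ k ≟ℕ b ⌋ then suc b else b))) (upTo (suc b))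

rgs : (n : ℕ) → List (Vec ℕ n)
rgs n = List.map Data.Product.proj₁ (rgs′ n)

record Partition (n : ℕ) : Set where
  constructor part
  field
    labels    : Vec ℕ n
    canonical : labels ∈ rgs n

open Partition public

allPartitions : (n : ℕ) → List (Partition n)
allPartitions n = mapWith∈ (rgs n) (λ {v} p → part v p)

SameBlock : {n : ℕ} → Partition n → Fin n → Fin n → Set
SameBlock π i j = lookup (labels π) i ≡ lookup (labels π) j

allᵇ : {A : Set} → (A → Bool) → List A → Bool
allᵇ p = foldr (λ x r → p x ∧ r) true

_≤ᵇ_ : {n : ℕ} → Vec ℕ n → Vec ℕ n → Bool
_≤ᵇ_ {n} σ π = allᵇ (λ i → allᵇ (λ j →
    if ⌊ lookup σ i ≟ℕ lookup σ j ⌋ then ⌊ lookup π i ≟ℕ lookup π j ⌋ else true)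
    (allFin n)) (allFin n)

_≡ᵇ_ : {n : ℕ} → Vec ℕ n → Vec ℕ n → Bool
σ ≡ᵇ π = ⌊ ≡-dec _≟ℕ_ σ π ⌋

module _ (R : CommutativeRing c ℓ) where
  open CommutativeRing R

  Σ[_] : List Carrier → Carrier
  Σ[_] = foldr _+_ 0#

  -- Möbius function of the finite poset (Πₙ, ≤), via its defining recursion
  -- μ(σ,σ) = 1, μ(σ,π) = - Σ_{σ ≤ τ < π} μ(σ,τ) for σ < π, μ(σ,π) = 0 otherwise;
  -- computed with fuel (chains in Πₙ have fewer than |Πₙ| steps).
  möbius′ : {n : ℕ} → ℕ → Vec ℕ n → Vec ℕ n → Carrier
  möbius′ zero    σ π = 0#
  möbius′ {n} (suc k) σ π =
    if σ ≡ᵇ π then 1#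
    else if σ ≤ᵇ π then - Σ[ List.map (möbius′ k σ)
                              (filter (λ τ → T? ((σ ≤ᵇ τ) ∧ (τ ≤ᵇ π) ∧ not (τ ≡ᵇ π))) (rgs n)) ]
    else 0#

  μ : {n : ℕ} → Partition n → Partition n → Carrier
  μ {n} σ π = möbius′ (length (rgs n)) (labels σ) (labels π)

module _ {R : CommutativeRing c ℓ} {P : NCPS R a ℓa} {u ℓu : Level}
         (E : ExchangeabilitySystem P u ℓu) where
  private
    module P = NCPS P
    module E = ExchangeabilitySystem E
    module U = NCPS E.𝒰
  open CommutativeRing R

  -- φ_σ(X₁,…,Xₙ) = φ̃(X₁^(i₁) ⋯ Xₙ^(iₙ)) for the index map i = labels of σ
  -- (whose kernel is σ; by exchangeability any such i gives the same value).
  φ[_] : {n : ℕ} → Partition n → (Fin n → P.Carrier) → Carrier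
  φ[ σ ] X = U.φ (prod U.alg (λ m → X m E.⁽ lookup (labels σ) m ⁾))

  K[_] : {n : ℕ} → Partition n → (Fin n → P.Carrier) → Carrier
  K[_] {n} π X = Σ[_] R (List.map (λ σ → φ[ σ ] X * μ R σ π)
                  (List.filter (λ σ → T? (labels σ ≤ᵇ labels π)) (allPartitions n)))

  record IsSubalgebra {p : Level} (B : P.Carrier → Set p) : Set (c ⊔ a ⊔ ℓa ⊔ p) where
    field
      resp : ∀ {x y} → x P.≈ y → B x → B y
      0∈   : B P.0a
      +∈   : ∀ {x y} → B x → B y → B (x P.+ y)
      ·∈   : ∀ r {x} → B x → B (r P.· x)
      *∈   : ∀ {x y} → B x → B y → B (x P.* y)

  -- The splitting [n] = I ⊎ J is given by
  -- s : Fin n → Bool (I = s⁻¹(true), J = s⁻¹(false)); π|_I = π′|_I means the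
  -- two partitions relate exactly the same pairs of indices of I.
  SameOn : {n : ℕ} → (Fin n → Bool) → Bool → Partition n → Partition n → Set
  SameOn s b π π′ = ∀ i j → s i ≡ b → s j ≡ b →
    (SameBlock π i j → SameBlock π′ i j) × (SameBlock π′ i j → SameBlock π i j)

  Independent : {p q : Level} → (P.Carrier → Set p) → (P.Carrier → Set q) → Set (ℓ ⊔ a ⊔ p ⊔ q)
  Independent B C = ∀ (n : ℕ) (X : Fin n → P.Carrier) (s : Fin n → Bool) →
    (∀ i → s i ≡ true → B (X i)) → (∀ i → s i ≡ false → C (X i)) →
    ∀ (π π′ : Partition n) → SameOn s true π π′ → SameOn s false π π′ →
    φ[ π ] X ≈ φ[ π′ ] X

-- Let ρ be the two-block partition separating the indices of B-variables from those of
-- C-variables. E-independence says precisely that φ_σ = φ_{σ ∧ ρ} for every σ ∈ Πₙ.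
-- By Möbius inversion φ_σ = Σ_{τ ≤ σ} K_τ, so the function d(τ) = [τ ≰ ρ] K_τ has
-- partial sums Σ_{τ ≤ σ} d(τ) = φ_σ − Σ_{τ ≤ σ ∧ ρ} K_τ = φ_σ − φ_{σ ∧ ρ} = 0 for all σ,
-- and induction over Πₙ gives d = 0. A partition π with a block meeting both B and C
-- is not below ρ, hence K_π = d(π) = 0.
module Submission where

open import Defs
open import Level using (Level; _⊔_)
open import Algebra.Bundles using (CommutativeRing)
open import Data.Nat as ℕ using (ℕ; zero; suc; _<_; _≤_; z≤n; s≤s)
import Data.Nat.Properties as ℕ
open import Data.Bool as Bool using (Bool; true; false; T; if_then_else_; _∧_; not)
import Data.Bool.Properties as Bool
open import Data.Fin as Fin using (Fin; inject₁; fromℕ)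
open import Data.Vec as Vec using (Vec; []; _∷_; _∷ʳ_; lookup)
open import Data.Vec.Properties using (≡-dec)
open import Data.List as List using (List; []; _∷_; filter; length)
open import Data.List.Membership.Propositional using (_∈_)
open import Data.List.Relation.Unary.Any using (here; there)
import Data.List.Relation.Unary.All as All
import Data.List.Relation.Unary.AllPairs as AllPairs
open import Data.List.Relation.Unary.Unique.Propositional using (Unique)
open import Data.Product using (Σ; ∃; _×_; _,_; proj₁; proj₂)
open import Data.Sum using (_⊎_; inj₁; inj₂; [_,_]′)
open import Data.Empty using (⊥-elim)
open import Function using (_∘_)
open import Relation.Unary using (Pred; Decidable)
open import Relation.Nullary using (¬_; Dec; yes; no; does; proof; _because_; Reflects; ofʸ; ofⁿ)
open import Relation.Nullary.Reflects using (_×-reflects_; ¬-reflects; det)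
open import Relation.Nullary.Decidable using (⌊_⌋; T?)
open import Relation.Binary.Definitions using (DecidableEquality)
open import Relation.Binary.PropositionalEquality as ≡ using (_≡_; _≢_)
import Relation.Binary.Reasoning.Setoid as SetoidReasoning

module SetPartitions where
  open import Data.Fin.Properties using (any?; all?)
  open import Data.Vec.Properties using (∷ʳ-injectiveʳ; init-∷ʳ)
  open import Data.List using (concatMap; upTo; allFin)
  open import Data.List.Properties using (map-concatMap; map-∘)
  open import Data.List.Membership.Propositional using (find; lose)
  open import Data.List.Membership.Propositional.Properties
    using (∈-map⁺; ∈-map⁻; ∈-concatMap⁺; ∈-concatMap⁻; ∈-upTo⁺; ∈-upTo⁻)
  open import Data.List.Relation.Unary.All.Properties using (tabulate⁺; tabulate⁻)
  import Data.List.Relation.Unary.Unique.Propositional.Properties as Unique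
  open import Data.Product using (uncurry)
  open import Data.Product.Properties using () renaming (≡-dec to ×-≡-dec)
  open import Function.Bundles using (_⇔_; mk⇔)
  open import Relation.Nullary.Decidable using (_→-dec_)
  open ≡ using (refl; sym; trans; cong; cong₂; subst; _≗_)

  -- Kernels of labellings

  -- A labelling Fin n → A stands for the partition of [n] into its level sets.
  infix 4 _⊑_

  _⊑_ : {n : ℕ} {A B : Set} → (Fin n → A) → (Fin n → B) → Set
  f ⊑ g = ∀ i j → f i ≡ f j → g i ≡ g j

  SameKernel : {n : ℕ} {A B : Set} → (Fin n → A) → (Fin n → B) → Set
  SameKernel f g = f ⊑ g × g ⊑ f

  module _ {n : ℕ} {A B C : Set} {f : Fin n → A} {g : Fin n → B} {h : Fin n → C} where

    ⊑-trans : f ⊑ g → g ⊑ h → f ⊑ h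
    ⊑-trans f⊑g g⊑h i j = g⊑h i j ∘ f⊑g i j

    ⊑-⟨,⟩ : f ⊑ g → f ⊑ h → f ⊑ (λ i → g i , h i)
    ⊑-⟨,⟩ f⊑g f⊑h i j fi≡fj = cong₂ _,_ (f⊑g i j fi≡fj) (f⊑h i j fi≡fj)

    ⊑-proj₁ : f ⊑ (λ i → g i , h i) → f ⊑ g
    ⊑-proj₁ f⊑gh i j = cong proj₁ ∘ f⊑gh i j

    ⊑-proj₂ : f ⊑ (λ i → g i , h i) → f ⊑ h
    ⊑-proj₂ f⊑gh i j = cong proj₂ ∘ f⊑gh i j

  module _ {n : ℕ} {A B : Set} where

    ⊑-respʳ : {f : Fin n → A} {g g′ : Fin n → B} → g ≗ g′ → f ⊑ g → f ⊑ g′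
    ⊑-respʳ g≗g′ f⊑g i j fi≡fj = trans (sym (g≗g′ i)) (trans (f⊑g i j fi≡fj) (g≗g′ j))

    ⊑-respˡ : {f f′ : Fin n → A} {g : Fin n → B} → f ≗ f′ → f ⊑ g → f′ ⊑ g
    ⊑-respˡ f≗f′ f⊑g i j f′i≡f′j = f⊑g i j (trans (f≗f′ i) (trans f′i≡f′j (sym (f≗f′ j))))

    ⊑-dec : DecidableEquality A → DecidableEquality B → (f : Fin n → A) (g : Fin n → B) → Dec (f ⊑ g)
    ⊑-dec _≟ᴬ_ _≟ᴮ_ f g = all? λ i → all? λ j → (f i ≟ᴬ f j) →-dec (g i ≟ᴮ g j)

  lookup-∷ʳ-inject₁ : {n : ℕ} {A : Set} (v : Vec A n) (x : A) (i : Fin n) →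
                      lookup (v ∷ʳ x) (inject₁ i) ≡ lookup v i
  lookup-∷ʳ-inject₁ (y ∷ v) x Fin.zero    = refl
  lookup-∷ʳ-inject₁ (y ∷ v) x (Fin.suc i) = lookup-∷ʳ-inject₁ v x i

  lookup-∷ʳ-fromℕ : {n : ℕ} {A : Set} (v : Vec A n) (x : A) → lookup (v ∷ʳ x) (fromℕ n) ≡ x
  lookup-∷ʳ-fromℕ []      x = refl
  lookup-∷ʳ-fromℕ (y ∷ v) x = lookup-∷ʳ-fromℕ v x

  data SnocView : {n : ℕ} → Fin (suc n) → Set where
    last : {n : ℕ} → SnocView (fromℕ n)
    init : {n : ℕ} (i : Fin n) → SnocView (inject₁ i)

  snocView : {n : ℕ} (i : Fin (suc n)) → SnocView i
  snocView {zero}  Fin.zero    = last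
  snocView {suc n} Fin.zero    = init Fin.zero
  snocView {suc n} (Fin.suc i) with snocView i
  ... | last   = last
  ... | init j = init (Fin.suc j)

  ⊑-snoc : {n : ℕ} {A B : Set} {f : Fin (suc n) → A} {g : Fin (suc n) → B} →
           f ∘ inject₁ ⊑ g ∘ inject₁ →
           (∀ i → f (inject₁ i) ≡ f (fromℕ n) → g (inject₁ i) ≡ g (fromℕ n)) →
           f ⊑ g
  ⊑-snoc f⊑g row i j with snocView i | snocView j
  ... | last   | last   = λ _ → refl
  ... | init a | init b = f⊑g a b
  ... | init a | last   = row a
  ... | last   | init b = sym ∘ row b ∘ sym

  ⊑-∷ʳ⁻ : {n : ℕ} {A B : Set} (v : Vec A n) (w : Vec B n) {x : A} {y : B} →
          lookup (v ∷ʳ x) ⊑ lookup (w ∷ʳ y) → lookup v ⊑ lookup w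
  ⊑-∷ʳ⁻ v w {x} {y} h =
    ⊑-respʳ (lookup-∷ʳ-inject₁ w y) (⊑-respˡ (lookup-∷ʳ-inject₁ v x) (λ i j → h (inject₁ i) (inject₁ j)))

  module _ {n : ℕ} {A : Set} {f : Fin (suc n) → A} {v : Vec ℕ n} where

    sameKernel-∷ʳ-old : SameKernel (f ∘ inject₁) (lookup v) →
                        ∀ i → f (inject₁ i) ≡ f (fromℕ n) → SameKernel f (lookup (v ∷ʳ lookup v i))
    sameKernel-∷ʳ-old (f⊑v , v⊑f) i fi≡fn =
      ⊑-snoc (⊑-respʳ (sym ∘ lookup-∷ʳ-inject₁ v k) f⊑v) to-last ,
      ⊑-snoc (⊑-respˡ (sym ∘ lookup-∷ʳ-inject₁ v k) v⊑f) from-last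
      where
      k : ℕ
      k = lookup v i
      to-last : ∀ a → f (inject₁ a) ≡ f (fromℕ n) → lookup (v ∷ʳ k) (inject₁ a) ≡ lookup (v ∷ʳ k) (fromℕ n)
      to-last a e = trans (lookup-∷ʳ-inject₁ v k a)
                          (trans (f⊑v a i (trans e (sym fi≡fn))) (sym (lookup-∷ʳ-fromℕ v k)))
      from-last : ∀ a → lookup (v ∷ʳ k) (inject₁ a) ≡ lookup (v ∷ʳ k) (fromℕ n) → f (inject₁ a) ≡ f (fromℕ n)
      from-last a e = trans (v⊑f a i (trans (sym (lookup-∷ʳ-inject₁ v k a)) (trans e (lookup-∷ʳ-fromℕ v k))))
                            fi≡fn

    sameKernel-∷ʳ-new : SameKernel (f ∘ inject₁) (lookup v) → ∀ {b} →
                        (∀ i → f (inject₁ i) ≢ f (fromℕ n)) → (∀ i → lookup v i ≢ b) →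
                        SameKernel f (lookup (v ∷ʳ b))
    sameKernel-∷ʳ-new (f⊑v , v⊑f) {b} f-fresh b-fresh =
      ⊑-snoc (⊑-respʳ (sym ∘ lookup-∷ʳ-inject₁ v b) f⊑v) (λ a e → ⊥-elim (f-fresh a e)) ,
      ⊑-snoc (⊑-respˡ (sym ∘ lookup-∷ʳ-inject₁ v b) v⊑f) (λ a e →
        ⊥-elim (b-fresh a (trans (sym (lookup-∷ʳ-inject₁ v b a)) (trans e (lookup-∷ʳ-fromℕ v b)))))

  -- Restricted growth strings

  record ExactLabels {n : ℕ} (v : Vec ℕ n) (b : ℕ) : Set where
    field
      bounded : ∀ i → lookup v i < b
      onto    : ∀ k → k < b → ∃ λ i → lookup v i ≡ k
  open ExactLabels

  exactLabels-∷ʳ-new : {n b : ℕ} {v : Vec ℕ n} → ExactLabels v b → ExactLabels (v ∷ʳ b) (suc b)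
  exactLabels-∷ʳ-new {n} {b} {v} ex = record { bounded = bounded′ ; onto = onto′ }
    where
    bounded′ : ∀ i → lookup (v ∷ʳ b) i < suc b
    bounded′ i with snocView i
    ... | last   rewrite lookup-∷ʳ-fromℕ v b   = ℕ.≤-refl
    ... | init a rewrite lookup-∷ʳ-inject₁ v b a = ℕ.m<n⇒m<1+n (bounded ex a)
    onto′ : ∀ k → k < suc b → ∃ λ i → lookup (v ∷ʳ b) i ≡ k
    onto′ k k<1+b with ℕ.m≤n⇒m<n∨m≡n (ℕ.≤-pred k<1+b)
    ... | inj₂ refl = fromℕ n , lookup-∷ʳ-fromℕ v b
    ... | inj₁ k<b  with onto ex k k<b
    ...   | a , va≡k = inject₁ a , trans (lookup-∷ʳ-inject₁ v b a) va≡k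

  exactLabels-∷ʳ-old : {n b k : ℕ} {v : Vec ℕ n} → ExactLabels v b → k < b → ExactLabels (v ∷ʳ k) b
  exactLabels-∷ʳ-old {n} {b} {k} {v} ex k<b = record { bounded = bounded′ ; onto = onto′ }
    where
    bounded′ : ∀ i → lookup (v ∷ʳ k) i < b
    bounded′ i with snocView i
    ... | last   rewrite lookup-∷ʳ-fromℕ v k   = k<b
    ... | init a rewrite lookup-∷ʳ-inject₁ v k a = bounded ex a
    onto′ : ∀ j → j < b → ∃ λ i → lookup (v ∷ʳ k) i ≡ j
    onto′ j j<b with onto ex j j<b
    ... | a , va≡j = inject₁ a , trans (lookup-∷ʳ-inject₁ v k a) va≡j

  exactLabels-≤ : {n b b′ : ℕ} {v : Vec ℕ n} → ExactLabels v b → ExactLabels v b′ → b ≤ b′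
  exactLabels-≤ {b = b} {b′} ex ex′ = ℕ.≮⇒≥ λ b′<b →
    let (i , vi≡b′) = onto ex b′ b′<b in ℕ.<-irrefl vi≡b′ (bounded ex′ i)

  exactLabels-unique : {n b b′ : ℕ} {v : Vec ℕ n} → ExactLabels v b → ExactLabels v b′ → b ≡ b′
  exactLabels-unique ex ex′ = ℕ.≤-antisym (exactLabels-≤ ex ex′) (exactLabels-≤ ex′ ex)

  -- Written exactly as the block count in the extension step of rgs′, so that
  -- membership proofs in rgs′ (suc n) match it definitionally.
  blocksAfter : ℕ → ℕ → ℕ
  blocksAfter k b = if ⌊ k ℕ.≟ b ⌋ then suc b else b

  data RgsStep (n : ℕ) : Vec ℕ (suc n) → ℕ → Set where
    step : {v : Vec ℕ n} {b k : ℕ} → (v , b) ∈ rgs′ n → k ≤ b → RgsStep n (v ∷ʳ k) (blocksAfter k b)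

  ∈-rgs′-suc⁻ : {n c : ℕ} {u : Vec ℕ (suc n)} → (u , c) ∈ rgs′ (suc n) → RgsStep n u c
  ∈-rgs′-suc⁻ {n} u∈ with find (∈-concatMap⁻ _ {rgs′ n} u∈)
  ... | (v , b) , vb∈ , u∈ext with ∈-map⁻ _ u∈ext
  ...   | k , k∈ , refl = step vb∈ (ℕ.≤-pred (∈-upTo⁻ k∈))

  ∈-rgs′-suc⁺ : {n b k : ℕ} {v : Vec ℕ n} → (v , b) ∈ rgs′ n → k ≤ b →
                (v ∷ʳ k , blocksAfter k b) ∈ rgs′ (suc n)
  ∈-rgs′-suc⁺ {n} vb∈ k≤b = ∈-concatMap⁺ _ (lose vb∈ (∈-map⁺ _ (∈-upTo⁺ (s≤s k≤b))))

  rgs′-exactLabels : {n b : ℕ} {v : Vec ℕ n} → (v , b) ∈ rgs′ n → ExactLabels v b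
  rgs′-exactLabels {zero} {v = []} (here refl) = record { bounded = λ () ; onto = λ _ () }
  rgs′-exactLabels {suc n} u∈ with ∈-rgs′-suc⁻ u∈
  ... | step {b = b} {k} vb∈ k≤b with k ℕ.≟ b
  ...   | yes refl = exactLabels-∷ʳ-new (rgs′-exactLabels vb∈)
  ...   | no k≢b   = exactLabels-∷ʳ-old (rgs′-exactLabels vb∈) (ℕ.≤∧≢⇒< k≤b k≢b)

  -- An old label k is already carried by some earlier index, which pins down k′.
  snoc-label-determined : {n b k k′ : ℕ} {v : Vec ℕ n} → ExactLabels v b → k < b →
                          lookup (v ∷ʳ k) ⊑ lookup (v ∷ʳ k′) → k′ ≡ k
  snoc-label-determined {n} {k = k} {k′} {v} ex k<b v∷k⊑v∷k′ with onto ex k k<b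
  ... | a , va≡k = trans (sym (trans (sym (lookup-∷ʳ-inject₁ v k′ a))
                                     (trans (v∷k⊑v∷k′ (inject₁ a) (fromℕ n) same) (lookup-∷ʳ-fromℕ v k′))))
                         va≡k
    where
    same : lookup (v ∷ʳ k) (inject₁ a) ≡ lookup (v ∷ʳ k) (fromℕ n)
    same = trans (lookup-∷ʳ-inject₁ v k a) (trans va≡k (sym (lookup-∷ʳ-fromℕ v k)))

  rgs′-sameKernel⇒≡ : {n b b′ : ℕ} {v w : Vec ℕ n} → (v , b) ∈ rgs′ n → (w , b′) ∈ rgs′ n →
                      SameKernel (lookup v) (lookup w) → v ≡ w
  rgs′-sameKernel⇒≡ {zero} {v = []} {[]} _ _ _ = refl
  rgs′-sameKernel⇒≡ {suc n} v∈ w∈ (v⊑w , w⊑v) with ∈-rgs′-suc⁻ v∈ | ∈-rgs′-suc⁻ w∈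
  ... | step {v} {b} {k} vb∈ k≤b | step {w} {k = k′} wb∈ k′≤b′
    with refl ← rgs′-sameKernel⇒≡ vb∈ wb∈ (⊑-∷ʳ⁻ v w v⊑w , ⊑-∷ʳ⁻ w v w⊑v)
    with refl ← exactLabels-unique (rgs′-exactLabels vb∈) (rgs′-exactLabels wb∈)
    = cong (v ∷ʳ_) (lastLabel (ℕ.m≤n⇒m<n∨m≡n k≤b) (ℕ.m≤n⇒m<n∨m≡n k′≤b′))
    where
    ex : ExactLabels v b
    ex = rgs′-exactLabels vb∈
    lastLabel : k < b ⊎ k ≡ b → k′ < b ⊎ k′ ≡ b → k ≡ k′
    lastLabel (inj₁ k<b)  _           = sym (snoc-label-determined ex k<b v⊑w)
    lastLabel (inj₂ _)    (inj₁ k′<b) = snoc-label-determined ex k′<b w⊑v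
    lastLabel (inj₂ refl) (inj₂ refl) = refl

  rgs-sameKernel⇒≡ : {n : ℕ} {v w : Vec ℕ n} → v ∈ rgs n → w ∈ rgs n →
                     SameKernel (lookup v) (lookup w) → v ≡ w
  rgs-sameKernel⇒≡ v∈ w∈ with ∈-map⁻ proj₁ v∈ | ∈-map⁻ proj₁ w∈
  ... | _ , vb∈ , refl | _ , wb∈ , refl = rgs′-sameKernel⇒≡ vb∈ wb∈

  canonicalForm′ : {n : ℕ} {A : Set} → DecidableEquality A → (f : Fin n → A) →
                   Σ (Vec ℕ n × ℕ) λ (v , b) → (v , b) ∈ rgs′ n × SameKernel f (lookup v)
  canonicalForm′ {zero}  _≟_ f = ([] , 0) , here refl , (λ ()) , (λ ())
  canonicalForm′ {suc n} _≟_ f with canonicalForm′ _≟_ (f ∘ inject₁)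
  ... | (v , b) , vb∈ , f≋v with any? (λ i → f (inject₁ i) ≟ f (fromℕ n))
  ...   | yes (i , fi≡fn) = _ , ∈-rgs′-suc⁺ vb∈ (ℕ.<⇒≤ (bounded (rgs′-exactLabels vb∈) i)) ,
                            sameKernel-∷ʳ-old {v = v} f≋v i fi≡fn
  ...   | no ¬fi≡fn       = _ , ∈-rgs′-suc⁺ vb∈ ℕ.≤-refl ,
                            sameKernel-∷ʳ-new {v = v} f≋v (λ i e → ¬fi≡fn (i , e))
                              (λ i e → ℕ.<-irrefl e (bounded (rgs′-exactLabels vb∈) i))

  canonicalForm : {n : ℕ} {A : Set} → DecidableEquality A → (f : Fin n → A) →
                  Σ (Vec ℕ n) λ v → v ∈ rgs n × SameKernel f (lookup v)
  canonicalForm _≟_ f with canonicalForm′ _≟_ f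
  ... | (v , b) , vb∈ , f≋v = v , ∈-map⁺ proj₁ vb∈ , f≋v

  Unique-concatMap : {A B K : Set} (F : A → List B) (keyᴮ : B → K) (keyᴬ : A → K) (xs : List A) →
                     Unique (List.map keyᴬ xs) → (∀ x → Unique (F x)) →
                     (∀ x {y} → y ∈ F x → keyᴮ y ≡ keyᴬ x) → Unique (concatMap F xs)
  Unique-concatMap F keyᴮ keyᴬ []       _                  _        _     = AllPairs.[]
  Unique-concatMap F keyᴮ keyᴬ (x ∷ xs) (x∉xs AllPairs.∷ u) F-unique F-key =
    Unique.++⁺ (F-unique x) (Unique-concatMap F keyᴮ keyᴬ xs u F-unique F-key) disjoint
    where
    disjoint : ∀ {y} → ¬ (y ∈ F x × y ∈ concatMap F xs)
    disjoint (y∈Fx , y∈rest) with find (∈-concatMap⁻ F {xs} y∈rest)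
    ... | x′ , x′∈xs , y∈Fx′ =
      All.lookup x∉xs (∈-map⁺ keyᴬ x′∈xs) (trans (sym (F-key x y∈Fx)) (F-key x′ y∈Fx′))

  rgs-unique : (n : ℕ) → Unique (rgs n)
  rgs-unique zero    = All.[] AllPairs.∷ AllPairs.[]
  rgs-unique (suc n) = subst Unique (sym (map-concatMap proj₁ _ (rgs′ n)))
    (Unique-concatMap _ Vec.init proj₁ (rgs′ n) (rgs-unique n) extension-unique extension-init)
    where
    extension : Vec ℕ n × ℕ → List (Vec ℕ (suc n))
    extension (v , b) = List.map proj₁ (List.map (λ k → v ∷ʳ k , blocksAfter k b) (upTo (suc b)))
    extension-unique : ∀ vb → Unique (extension vb)
    extension-unique (v , b) =
      subst Unique (map-∘ (upTo (suc b))) (Unique.map⁺ (∷ʳ-injectiveʳ v v) (Unique.upTo⁺ (suc b)))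
    extension-init : ∀ vb {u} → u ∈ extension vb → Vec.init u ≡ proj₁ vb
    extension-init (v , b) u∈ with ∈-map⁻ proj₁ u∈
    ... | _ , u∈′ , refl with ∈-map⁻ _ u∈′
    ...   | k , _ , refl = init-∷ʳ k v

  -- The refinement order

  infix 4 _≼_

  _≼_ : {n : ℕ} → Vec ℕ n → Vec ℕ n → Set
  v ≼ w = lookup v ⊑ lookup w

  ≼-refl : {n : ℕ} {v : Vec ℕ n} → v ≼ v
  ≼-refl i j vi≡vj = vi≡vj

  ≼-trans : {n : ℕ} {u v w : Vec ℕ n} → u ≼ v → v ≼ w → u ≼ w
  ≼-trans = ⊑-trans

  ≼-antisym : {n : ℕ} {v w : Vec ℕ n} → v ∈ rgs n → w ∈ rgs n → v ≼ w → w ≼ v → v ≡ w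
  ≼-antisym v∈ w∈ v≼w w≼v = rgs-sameKernel⇒≡ v∈ w∈ (v≼w , w≼v)

  reflects-map : {a b : Level} {A : Set a} {B : Set b} {x : Bool} →
                 (A → B) → (B → A) → Reflects A x → Reflects B x
  reflects-map to from (ofʸ a)  = ofʸ (to a)
  reflects-map to from (ofⁿ ¬a) = ofⁿ (¬a ∘ from)

  reflects-witness : {p : Level} {P : Set p} {b : Bool} → Reflects P b → T b → P
  reflects-witness (ofʸ p) _ = p

  ⌊⌋-reflects : {A : Set} (a? : Dec A) → Reflects A ⌊ a? ⌋
  ⌊⌋-reflects (yes a) = ofʸ a
  ⌊⌋-reflects (no ¬a) = ofⁿ ¬a

  allᵇ-reflects : {A : Set} {P : A → Set} {p : A → Bool} →
                  (∀ x → Reflects (P x) (p x)) → ∀ xs → Reflects (All.All P xs) (allᵇ p xs)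
  allᵇ-reflects r []       = ofʸ All.[]
  allᵇ-reflects r (x ∷ xs) =
    reflects-map (uncurry All._∷_) (λ { (px All.∷ pxs) → px , pxs }) (r x ×-reflects allᵇ-reflects r xs)

  implication-reflects : {A B : Set} {a b : Bool} → Reflects A a → Reflects B b →
                         Reflects (A → B) (if a then b else true)
  implication-reflects (ofʸ a)  (ofʸ b)  = ofʸ (λ _ → b)
  implication-reflects (ofʸ a)  (ofⁿ ¬b) = ofⁿ (λ a→b → ¬b (a→b a))
  implication-reflects (ofⁿ ¬a) _        = ofʸ (⊥-elim ∘ ¬a)

  ≤ᵇ-reflects : {n : ℕ} (v w : Vec ℕ n) → Reflects (v ≼ w) (v ≤ᵇ w)
  ≤ᵇ-reflects {n} v w =
    reflects-map (λ all i → tabulate⁻ (tabulate⁻ all i)) (λ v≼w → tabulate⁺ λ i → tabulate⁺ (v≼w i))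
      (allᵇ-reflects (λ i → allᵇ-reflects (λ j →
         implication-reflects (⌊⌋-reflects (lookup v i ℕ.≟ lookup v j))
                              (⌊⌋-reflects (lookup w i ℕ.≟ lookup w j)))
         (allFin n)) (allFin n))

  ≡ᵇ-reflects : {n : ℕ} (v w : Vec ℕ n) → Reflects (v ≡ w) (v ≡ᵇ w)
  ≡ᵇ-reflects v w = ⌊⌋-reflects (≡-dec ℕ._≟_ v w)

  _≼?_ : {n : ℕ} (v w : Vec ℕ n) → Dec (v ≼ w)
  v ≼? w = (v ≤ᵇ w) because ≤ᵇ-reflects v w

  -- σ ∧ {s⁻¹(true), s⁻¹(false)}: the canonical form of the labelling i ↦ (σᵢ, sᵢ).
  module _ {n : ℕ} (s : Fin n → Bool) (σ : Vec ℕ n) where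

    private
      meetForm : Σ (Vec ℕ n) λ v → v ∈ rgs n × SameKernel (λ i → lookup σ i , s i) (lookup v)
      meetForm = canonicalForm (×-≡-dec ℕ._≟_ Bool._≟_) (λ i → lookup σ i , s i)

    meetSplit : Vec ℕ n
    meetSplit = proj₁ meetForm

    meetSplit∈ : meetSplit ∈ rgs n
    meetSplit∈ = proj₁ (proj₂ meetForm)

    private
      σs⊑m : (λ i → lookup σ i , s i) ⊑ lookup meetSplit
      σs⊑m = proj₁ (proj₂ (proj₂ meetForm))
      m⊑σs : lookup meetSplit ⊑ (λ i → lookup σ i , s i)
      m⊑σs = proj₂ (proj₂ (proj₂ meetForm))

    meetSplit-meet : ∀ τ → τ ≼ meetSplit ⇔ (lookup τ ⊑ s × τ ≼ σ)
    meetSplit-meet τ = mk⇔ (λ τ≼m → ⊑-proj₂ (⊑-trans τ≼m m⊑σs) , ⊑-proj₁ (⊑-trans τ≼m m⊑σs))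
                           (λ (τ⊑s , τ≼σ) → ⊑-trans (⊑-⟨,⟩ τ≼σ τ⊑s) σs⊑m)

    meetSplit-agrees : ∀ i j → s i ≡ s j →
                       (lookup meetSplit i ≡ lookup meetSplit j → lookup σ i ≡ lookup σ j) ×
                       (lookup σ i ≡ lookup σ j → lookup meetSplit i ≡ lookup meetSplit j)
    meetSplit-agrees i j si≡sj = ⊑-proj₁ m⊑σs i j , λ σi≡σj → σs⊑m i j (cong₂ _,_ σi≡σj si≡sj)

  module _ {A : Set} {p q : Level} {P : Pred A p} {Q : Pred A q} (P? : Decidable P) (Q? : Decidable Q) where

    length-filter-mono : (xs : List A) → (∀ {x} → x ∈ xs → P x → Q x) →
                         length (filter P? xs) ≤ length (filter Q? xs)
    length-filter-mono []       _   = z≤n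
    length-filter-mono (x ∷ xs) P⇒Q with P? x | Q? x
    ... | yes _  | yes _  = s≤s (length-filter-mono xs (P⇒Q ∘ there))
    ... | yes px | no ¬qx = ⊥-elim (¬qx (P⇒Q (here refl) px))
    ... | no _   | yes _  = ℕ.m≤n⇒m≤1+n (length-filter-mono xs (P⇒Q ∘ there))
    ... | no _   | no _   = length-filter-mono xs (P⇒Q ∘ there)

    length-filter-strict : (xs : List A) → (∀ {x} → x ∈ xs → P x → Q x) →
                           ∀ {y} → y ∈ xs → Q y → ¬ P y → length (filter P? xs) < length (filter Q? xs)
    length-filter-strict (x ∷ xs) P⇒Q (here refl) qy ¬py with P? x | Q? x
    ... | yes py | _      = ⊥-elim (¬py py)
    ... | no _   | yes _  = s≤s (length-filter-mono xs (P⇒Q ∘ there))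
    ... | no _   | no ¬qy = ⊥-elim (¬qy qy)
    length-filter-strict (x ∷ xs) P⇒Q (there y∈) qy ¬py with P? x | Q? x
    ... | yes _  | yes _  = s≤s (length-filter-strict xs (P⇒Q ∘ there) y∈ qy ¬py)
    ... | yes px | no ¬qx = ⊥-elim (¬qx (P⇒Q (here refl) px))
    ... | no _   | yes _  = ℕ.m≤n⇒m≤1+n (length-filter-strict xs (P⇒Q ∘ there) y∈ qy ¬py)
    ... | no _   | no _   = length-filter-strict xs (P⇒Q ∘ there) y∈ qy ¬py

open SetPartitions

module Sums {c ℓ : Level} (R : CommutativeRing c ℓ) where
  open CommutativeRing R
  open import Algebra.Properties.CommutativeSemigroup +-commutativeSemigroup using (interchange)

  when : Bool → Carrier → Carrier
  when b x = if b then x else 0#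

  ∑ : {A : Set} → List A → (A → Carrier) → Carrier
  ∑ xs g = Σ[_] R (List.map g xs)

  module _ {A : Set} where

    ∑-cong : (xs : List A) {g h : A → Carrier} → (∀ {x} → x ∈ xs → g x ≈ h x) → ∑ xs g ≈ ∑ xs h
    ∑-cong []       g≈h = refl
    ∑-cong (x ∷ xs) g≈h = +-cong (g≈h (here ≡.refl)) (∑-cong xs (g≈h ∘ there))

    ∑-zero : (xs : List A) {g : A → Carrier} → (∀ {x} → x ∈ xs → g x ≈ 0#) → ∑ xs g ≈ 0#
    ∑-zero []       g≈0 = refl
    ∑-zero (x ∷ xs) g≈0 = trans (+-cong (g≈0 (here ≡.refl)) (∑-zero xs (g≈0 ∘ there))) (+-identityˡ 0#)

    ∑-+ : (xs : List A) (g h : A → Carrier) → ∑ xs (λ x → g x + h x) ≈ ∑ xs g + ∑ xs h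
    ∑-+ []       g h = sym (+-identityˡ 0#)
    ∑-+ (x ∷ xs) g h = trans (+-congˡ (∑-+ xs g h)) (interchange (g x) (h x) (∑ xs g) (∑ xs h))

    ∑-*ˡ : (xs : List A) (a : Carrier) (g : A → Carrier) → a * ∑ xs g ≈ ∑ xs (λ x → a * g x)
    ∑-*ˡ []       a g = zeroʳ a
    ∑-*ˡ (x ∷ xs) a g = trans (distribˡ a (g x) (∑ xs g)) (+-congˡ (∑-*ˡ xs a g))

    ∑-filter : (p : A → Bool) (xs : List A) (g : A → Carrier) →
               ∑ (filter (T? ∘ p) xs) g ≈ ∑ xs (λ x → when (p x) (g x))
    ∑-filter p []       g = refl
    ∑-filter p (x ∷ xs) g with p x
    ... | true  = +-congˡ (∑-filter p xs g)
    ... | false = trans (∑-filter p xs g) (sym (+-identityˡ _))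

    ∑-when-≟ : (_≟_ : DecidableEquality A) {xs : List A} → Unique xs → ∀ {x} → x ∈ xs →
               (g : A → Carrier) → ∑ xs (λ y → when ⌊ y ≟ x ⌋ (g y)) ≈ g x
    ∑-when-≟ _≟_ {y ∷ xs} (y∉xs AllPairs.∷ _) (here ≡.refl) g with y ≟ y
    ... | no y≢y = ⊥-elim (y≢y ≡.refl)
    ... | yes _  = trans (+-congˡ (∑-zero xs others-vanish)) (+-identityʳ (g y))
      where
      others-vanish : ∀ {z} → z ∈ xs → when ⌊ z ≟ y ⌋ (g z) ≈ 0#
      others-vanish {z} z∈ with z ≟ y
      ... | yes z≡y = ⊥-elim (All.lookup y∉xs z∈ (≡.sym z≡y))
      ... | no _    = refl
    ∑-when-≟ _≟_ {y ∷ xs} (y∉xs AllPairs.∷ u) {x} (there x∈) g with y ≟ x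
    ... | yes ≡.refl = ⊥-elim (All.lookup y∉xs x∈ ≡.refl)
    ... | no _       = trans (+-identityˡ _) (∑-when-≟ _≟_ u x∈ g)

  ∑-swap : {A B : Set} (xs : List A) (ys : List B) (g : A → B → Carrier) →
           ∑ xs (λ x → ∑ ys (g x)) ≈ ∑ ys (λ y → ∑ xs (λ x → g x y))
  ∑-swap []       ys g = sym (∑-zero ys (λ _ → refl))
  ∑-swap (x ∷ xs) ys g = trans (+-congˡ (∑-swap xs ys g)) (sym (∑-+ ys (g x) _))

  when-true : {p : Level} {P : Set p} {b : Bool} → Reflects P b → P → ∀ x → when b x ≈ x
  when-true (ofʸ _)  _ x = refl
  when-true (ofⁿ ¬p) p x = ⊥-elim (¬p p)

  when-false : {p : Level} {P : Set p} {b : Bool} → Reflects P b → ¬ P → ∀ x → when b x ≈ 0#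
  when-false (ofʸ p) ¬p x = ⊥-elim (¬p p)
  when-false (ofⁿ _) _  x = refl

  when-when : (a b : Bool) (x : Carrier) → when a (when b x) ≈ when (b ∧ a) x
  when-when true  true  x = refl
  when-when true  false x = refl
  when-when false true  x = refl
  when-when false false x = refl

  when-split : (b c : Bool) (x : Carrier) → when b x ≈ when (c ∧ b) x + when (not c ∧ b) x
  when-split true  true  x = sym (+-identityʳ x)
  when-split true  false x = sym (+-identityˡ x)
  when-split false true  x = sym (+-identityˡ 0#)
  when-split false false x = sym (+-identityˡ 0#)

  when-*ˡ : (b : Bool) (a x : Carrier) → when b (a * x) ≈ a * when b x
  when-*ˡ true  a x = refl
  when-*ˡ false a x = sym (zeroʳ a)

  *-when-1# : (b : Bool) (x : Carrier) → x * when b 1# ≈ when b x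
  *-when-1# true  x = *-identityʳ x
  *-when-1# false x = zeroʳ x

  when-∑ : {A : Set} (b : Bool) (xs : List A) (g : A → Carrier) → when b (∑ xs g) ≈ ∑ xs (λ x → when b (g x))
  when-∑ true  xs g = refl
  when-∑ false xs g = sym (∑-zero xs (λ _ → refl))

-- Möbius inversion on the lattice of set partitions

module Möbius {c ℓ : Level} (R : CommutativeRing c ℓ) (n : ℕ) where
  open import Data.List.Properties using (length-filter; filter-some)
  open import Data.List.Membership.Propositional using (lose)
  open import Data.List.Membership.Propositional.Properties using (∈-filter⁻; map-mapWith∈; mapWith∈≗map)
  open import Function.Bundles using (_⇔_; module Equivalence)
  open CommutativeRing R
  open import Algebra.Properties.Ring ring using (+-identityʳ-unique)
  open SetoidReasoning setoid
  open Sums R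

  Πₙ : List (Vec ℕ n)
  Πₙ = rgs n

  #↓ : Vec ℕ n → ℕ
  #↓ τ = length (filter (_≼? τ) Πₙ)

  #↓-pos : ∀ {τ} → τ ∈ Πₙ → 0 < #↓ τ
  #↓-pos {τ} τ∈ = filter-some (_≼? τ) (lose τ∈ (≼-refl {v = τ}))

  #↓-strict : ∀ {x τ} → x ∈ Πₙ → τ ∈ Πₙ → x ≼ τ → x ≢ τ → #↓ x < #↓ τ
  #↓-strict {x} {τ} x∈ τ∈ x≼τ x≢τ =
    length-filter-strict (_≼? x) (_≼? τ) Πₙ (λ {y} _ y≼x → ≼-trans {u = y} {x} {τ} y≼x x≼τ)
      τ∈ (≼-refl {v = τ}) (λ τ≼x → x≢τ (≼-antisym {v = x} {τ} x∈ τ∈ x≼τ τ≼x))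

  strictlyBetween : Vec ℕ n → Vec ℕ n → Vec ℕ n → Bool
  strictlyBetween ρ σ τ = ρ ≤ᵇ τ ∧ τ ≤ᵇ σ ∧ not (τ ≡ᵇ σ)

  strictlyBetween-reflects : ∀ ρ σ τ → Reflects (ρ ≼ τ × τ ≼ σ × τ ≢ σ) (strictlyBetween ρ σ τ)
  strictlyBetween-reflects ρ σ τ =
    ≤ᵇ-reflects ρ τ ×-reflects ≤ᵇ-reflects τ σ ×-reflects ¬-reflects (≡ᵇ-reflects τ σ)

  -- The recursion for μ(ρ, τ) only calls μ(ρ, x) for x strictly below τ, so #↓ τ units
  -- of fuel already give the final value.
  möbius′-fuel : ∀ {k k′ ρ τ} → τ ∈ Πₙ → #↓ τ ≤ k → #↓ τ ≤ k′ → möbius′ R k ρ τ ≈ möbius′ R k′ ρ τ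
  möbius′-fuel {zero}         τ∈ #τ≤0 _    = ⊥-elim (ℕ.n≮0 (ℕ.<-≤-trans (#↓-pos τ∈) #τ≤0))
  möbius′-fuel {suc _} {zero} τ∈ _    #τ≤0 = ⊥-elim (ℕ.n≮0 (ℕ.<-≤-trans (#↓-pos τ∈) #τ≤0))
  möbius′-fuel {suc k} {suc k′} {ρ} {τ} τ∈ #τ≤1+k #τ≤1+k′ with ρ ≡ᵇ τ | ρ ≤ᵇ τ
  ... | true  | _     = refl
  ... | false | false = refl
  ... | false | true  = -‿cong (∑-cong (filter (T? ∘ strictlyBetween ρ τ) Πₙ) recurse)
    where
    recurse : ∀ {x} → x ∈ filter (T? ∘ strictlyBetween ρ τ) Πₙ → möbius′ R k ρ x ≈ möbius′ R k′ ρ x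
    recurse {x} x∈ with ∈-filter⁻ (T? ∘ strictlyBetween ρ τ) x∈
    ... | x∈Πₙ , between with reflects-witness (strictlyBetween-reflects ρ τ x) between
    ...   | _ , x≼τ , x≢τ = möbius′-fuel x∈Πₙ (below #τ≤1+k) (below #τ≤1+k′)
      where
      below : ∀ {m} → #↓ τ ≤ suc m → #↓ x ≤ m
      below #τ≤1+m = ℕ.≤-pred (ℕ.<-≤-trans (#↓-strict x∈Πₙ τ∈ x≼τ x≢τ) #τ≤1+m)

  μᵥ : Vec ℕ n → Vec ℕ n → Carrier
  μᵥ = möbius′ R (length Πₙ)

  μᵥ-unfold : ∀ {ρ τ} → τ ∈ Πₙ → μᵥ ρ τ ≈ möbius′ R (suc (length Πₙ)) ρ τ
  μᵥ-unfold {τ = τ} τ∈ =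
    möbius′-fuel τ∈ (length-filter (_≼? τ) Πₙ) (ℕ.m≤n⇒m≤1+n (length-filter (_≼? τ) Πₙ))

  μᵥ-diag : ∀ {ρ} → ρ ∈ Πₙ → μᵥ ρ ρ ≈ 1#
  μᵥ-diag {ρ} ρ∈ with ρ ≡ᵇ ρ | ≡ᵇ-reflects ρ ρ | μᵥ-unfold {ρ} ρ∈
  ... | true  | _       | μρρ≈1 = μρρ≈1
  ... | false | ofⁿ ρ≢ρ | _     = ⊥-elim (ρ≢ρ ≡.refl)

  μᵥ-rec : ∀ {ρ τ} → τ ∈ Πₙ → ρ ≼ τ → ρ ≢ τ →
           μᵥ ρ τ ≈ - ∑ Πₙ (λ x → when (strictlyBetween ρ τ x) (μᵥ ρ x))
  μᵥ-rec {ρ} {τ} τ∈ ρ≼τ ρ≢τ with ρ ≡ᵇ τ | ≡ᵇ-reflects ρ τ | ρ ≤ᵇ τ | ≤ᵇ-reflects ρ τ | μᵥ-unfold {ρ} τ∈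
  ... | true  | ofʸ ρ≡τ | _     | _       | _     = ⊥-elim (ρ≢τ ρ≡τ)
  ... | false | _       | false | ofⁿ ρ⋠τ | _     = ⊥-elim (ρ⋠τ ρ≼τ)
  ... | false | _       | true  | _       | μρτ≈ =
    trans μρτ≈ (-‿cong (∑-filter (strictlyBetween ρ τ) Πₙ (μᵥ ρ)))

  ∑-peel : ∀ {σ} → σ ∈ Πₙ → (p : Vec ℕ n → Bool) (g : Vec ℕ n → Carrier) →
           ∑ Πₙ (λ τ → when (p τ ∧ τ ≤ᵇ σ) (g τ)) ≈
           when (p σ) (g σ) + ∑ Πₙ (λ τ → when (p τ ∧ τ ≤ᵇ σ ∧ not (τ ≡ᵇ σ)) (g τ))
  ∑-peel {σ} σ∈ p g = begin
    ∑ Πₙ (λ τ → when (p τ ∧ τ ≤ᵇ σ) (g τ))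
      ≈⟨ ∑-cong Πₙ (λ {τ} _ → split-top τ (p τ) (g τ)) ⟩
    ∑ Πₙ (λ τ → when (τ ≡ᵇ σ) (when (p τ) (g τ)) + when (p τ ∧ τ ≤ᵇ σ ∧ not (τ ≡ᵇ σ)) (g τ))
      ≈⟨ ∑-+ Πₙ _ _ ⟩
    ∑ Πₙ (λ τ → when (τ ≡ᵇ σ) (when (p τ) (g τ))) + ∑ Πₙ (λ τ → when (p τ ∧ τ ≤ᵇ σ ∧ not (τ ≡ᵇ σ)) (g τ))
      ≈⟨ +-congʳ (∑-when-≟ (≡-dec ℕ._≟_) (rgs-unique n) σ∈ (λ τ → when (p τ) (g τ))) ⟩
    when (p σ) (g σ) + ∑ Πₙ (λ τ → when (p τ ∧ τ ≤ᵇ σ ∧ not (τ ≡ᵇ σ)) (g τ)) ∎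
    where
    split-top : ∀ τ a x → when (a ∧ τ ≤ᵇ σ) x ≈ when (τ ≡ᵇ σ) (when a x) + when (a ∧ τ ≤ᵇ σ ∧ not (τ ≡ᵇ σ)) x
    split-top τ a x with τ ≡ᵇ σ | ≡ᵇ-reflects τ σ
    ... | false | _ =
      sym (trans (+-identityˡ _) (reflexive (≡.cong (λ b → when (a ∧ b) x) (Bool.∧-identityʳ (τ ≤ᵇ σ)))))
    ... | true  | ofʸ ≡.refl with τ ≤ᵇ τ | ≤ᵇ-reflects τ τ
    ...   | false | ofⁿ τ⋠τ = ⊥-elim (τ⋠τ (≼-refl {v = τ}))
    ...   | true  | _ with a
    ...     | true  = sym (+-identityʳ x)
    ...     | false = sym (+-identityʳ 0#)

  ∑-μᵥ-interval : ∀ {ρ σ} → ρ ∈ Πₙ → σ ∈ Πₙ →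
                  ∑ Πₙ (λ τ → when (ρ ≤ᵇ τ ∧ τ ≤ᵇ σ) (μᵥ ρ τ)) ≈ when (ρ ≡ᵇ σ) 1#
  ∑-μᵥ-interval {ρ} {σ} ρ∈ σ∈ with ρ ≼? σ
  ... | no ρ⋠σ = trans (∑-zero Πₙ (λ {τ} _ → when-false (≤ᵇ-reflects ρ τ ×-reflects ≤ᵇ-reflects τ σ)
                                     (λ (ρ≼τ , τ≼σ) → ρ⋠σ (≼-trans {u = ρ} {τ} {σ} ρ≼τ τ≼σ)) _))
                       (sym (when-false (≡ᵇ-reflects ρ σ) (λ { ≡.refl → ρ⋠σ (≼-refl {v = ρ}) }) 1#))
  ... | yes ρ≼σ = begin
    ∑ Πₙ (λ τ → when (ρ ≤ᵇ τ ∧ τ ≤ᵇ σ) (μᵥ ρ τ)) ≈⟨ ∑-peel σ∈ (ρ ≤ᵇ_) (μᵥ ρ) ⟩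
    when (ρ ≤ᵇ σ) (μᵥ ρ σ) + strictSum          ≈⟨ +-congʳ (when-true (≤ᵇ-reflects ρ σ) ρ≼σ _) ⟩
    μᵥ ρ σ + strictSum                          ≈⟨ top ⟩
    when (ρ ≡ᵇ σ) 1#                            ∎
    where
    strictSum : Carrier
    strictSum = ∑ Πₙ (λ τ → when (strictlyBetween ρ σ τ) (μᵥ ρ τ))
    top : μᵥ ρ σ + strictSum ≈ when (ρ ≡ᵇ σ) 1#
    top with ρ ≡ᵇ σ | ≡ᵇ-reflects ρ σ
    ... | true  | ofʸ ≡.refl = trans (+-cong (μᵥ-diag ρ∈) (∑-zero Πₙ empty)) (+-identityʳ 1#)
      where
      empty : ∀ {τ} → τ ∈ Πₙ → when (strictlyBetween ρ ρ τ) (μᵥ ρ τ) ≈ 0#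
      empty {τ} τ∈ = when-false (strictlyBetween-reflects ρ ρ τ)
        (λ (ρ≼τ , τ≼ρ , τ≢ρ) → τ≢ρ (≼-antisym {v = τ} {ρ} τ∈ ρ∈ τ≼ρ ρ≼τ)) _
    ... | false | ofⁿ ρ≢σ = trans (+-congʳ (μᵥ-rec σ∈ ρ≼σ ρ≢σ)) (-‿inverseˡ strictSum)

  cumulant : (Vec ℕ n → Carrier) → Vec ℕ n → Carrier
  cumulant f τ = ∑ Πₙ (λ ρ → when (ρ ≤ᵇ τ) (f ρ * μᵥ ρ τ))

  ∑-cumulant : (f : Vec ℕ n → Carrier) → ∀ {σ} → σ ∈ Πₙ → ∑ Πₙ (λ τ → when (τ ≤ᵇ σ) (cumulant f τ)) ≈ f σ
  ∑-cumulant f {σ} σ∈ = begin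
    ∑ Πₙ (λ τ → when (τ ≤ᵇ σ) (∑ Πₙ (λ ρ → when (ρ ≤ᵇ τ) (f ρ * μᵥ ρ τ))))
      ≈⟨ ∑-cong Πₙ (λ {τ} _ → trans (when-∑ (τ ≤ᵇ σ) Πₙ _)
                                     (∑-cong Πₙ (λ {ρ} _ → when-when (τ ≤ᵇ σ) (ρ ≤ᵇ τ) _))) ⟩
    ∑ Πₙ (λ τ → ∑ Πₙ (λ ρ → when (ρ ≤ᵇ τ ∧ τ ≤ᵇ σ) (f ρ * μᵥ ρ τ)))
      ≈⟨ ∑-swap Πₙ Πₙ _ ⟩
    ∑ Πₙ (λ ρ → ∑ Πₙ (λ τ → when (ρ ≤ᵇ τ ∧ τ ≤ᵇ σ) (f ρ * μᵥ ρ τ)))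
      ≈⟨ ∑-cong Πₙ (λ {ρ} _ → trans (∑-cong Πₙ (λ {τ} _ → when-*ˡ (ρ ≤ᵇ τ ∧ τ ≤ᵇ σ) (f ρ) _))
                                     (sym (∑-*ˡ Πₙ (f ρ) _))) ⟩
    ∑ Πₙ (λ ρ → f ρ * ∑ Πₙ (λ τ → when (ρ ≤ᵇ τ ∧ τ ≤ᵇ σ) (μᵥ ρ τ)))
      ≈⟨ ∑-cong Πₙ (λ {ρ} ρ∈ → trans (*-congˡ (∑-μᵥ-interval ρ∈ σ∈)) (*-when-1# (ρ ≡ᵇ σ) (f ρ))) ⟩
    ∑ Πₙ (λ ρ → when (ρ ≡ᵇ σ) (f ρ))
      ≈⟨ ∑-when-≟ (≡-dec ℕ._≟_) (rgs-unique n) σ∈ f ⟩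
    f σ ∎

  ∑↓≈0⇒≈0 : (d : Vec ℕ n → Carrier) → (∀ {σ} → σ ∈ Πₙ → ∑ Πₙ (λ τ → when (τ ≤ᵇ σ) (d τ)) ≈ 0#) →
            ∀ {σ} → σ ∈ Πₙ → d σ ≈ 0#
  ∑↓≈0⇒≈0 d ∑↓d≈0 {σ} σ∈ = go (#↓ σ) σ∈ ℕ.≤-refl
    where
    go : ∀ k {σ} → σ ∈ Πₙ → #↓ σ ≤ k → d σ ≈ 0#
    go zero    σ∈ #σ≤0 = ⊥-elim (ℕ.n≮0 (ℕ.<-≤-trans (#↓-pos σ∈) #σ≤0))
    go (suc k) {σ} σ∈ #σ≤1+k = begin
      d σ                                                  ≈⟨ +-identityʳ (d σ) ⟨
      d σ + 0#                                             ≈⟨ +-congˡ (∑-zero Πₙ strictly-below) ⟨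
      d σ + ∑ Πₙ (λ τ → when (τ ≤ᵇ σ ∧ not (τ ≡ᵇ σ)) (d τ)) ≈⟨ ∑-peel σ∈ (λ _ → true) d ⟨
      ∑ Πₙ (λ τ → when (τ ≤ᵇ σ) (d τ))                     ≈⟨ ∑↓d≈0 σ∈ ⟩
      0#                                                   ∎
      where
      strictly-below : ∀ {τ} → τ ∈ Πₙ → when (τ ≤ᵇ σ ∧ not (τ ≡ᵇ σ)) (d τ) ≈ 0#
      strictly-below {τ} τ∈
        with τ ≤ᵇ σ ∧ not (τ ≡ᵇ σ) | ≤ᵇ-reflects τ σ ×-reflects ¬-reflects (≡ᵇ-reflects τ σ)
      ... | false | _                = refl
      ... | true  | ofʸ (τ≼σ , τ≢σ) = go k τ∈ (ℕ.≤-pred (ℕ.<-≤-trans (#↓-strict τ∈ σ∈ τ≼σ τ≢σ) #σ≤1+k))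

  MeetWith : {p : Level} → (Vec ℕ n → Set p) → Vec ℕ n → Vec ℕ n → Set p
  MeetWith P σ m = ∀ τ → τ ≼ m ⇔ (P τ × τ ≼ σ)

  cumulant-vanishes : {p : Level} {P : Vec ℕ n → Set p} (P? : Decidable P) (f : Vec ℕ n → Carrier) →
                      (∀ {σ} → σ ∈ Πₙ → Σ (Vec ℕ n) λ m → m ∈ Πₙ × MeetWith P σ m × f m ≈ f σ) →
                      ∀ {π} → π ∈ Πₙ → ¬ P π → cumulant f π ≈ 0#
  cumulant-vanishes {P = P} P? f meet {π} π∈ ¬Pπ = begin
    K π ≈⟨ when-true (¬-reflects (proof (P? π))) ¬Pπ (K π) ⟨
    d π ≈⟨ ∑↓≈0⇒≈0 d ∑↓d≈0 π∈ ⟩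
    0#  ∎
    where
    K : Vec ℕ n → Carrier
    K = cumulant f
    inP : Vec ℕ n → Bool
    inP τ = does (P? τ)
    d : Vec ℕ n → Carrier
    d τ = when (not (inP τ)) (K τ)
    ∑↓d≈0 : ∀ {σ} → σ ∈ Πₙ → ∑ Πₙ (λ τ → when (τ ≤ᵇ σ) (d τ)) ≈ 0#
    ∑↓d≈0 {σ} σ∈ with meet σ∈
    ... | m , m∈ , m-meet , fm≈fσ = +-identityʳ-unique (f σ) _ (begin
      f σ + ∑ Πₙ (λ τ → when (τ ≤ᵇ σ) (d τ))
        ≈⟨ +-cong (sym fm≈fσ) (∑-cong Πₙ (λ {τ} _ → when-when (τ ≤ᵇ σ) (not (inP τ)) (K τ))) ⟩
      f m + ∑ Πₙ (λ τ → when (not (inP τ) ∧ τ ≤ᵇ σ) (K τ))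
        ≈⟨ +-congʳ (trans (sym (∑-cumulant f m∈)) (∑-cong Πₙ (λ {τ} _ → below-m τ))) ⟩
      ∑ Πₙ (λ τ → when (inP τ ∧ τ ≤ᵇ σ) (K τ)) + ∑ Πₙ (λ τ → when (not (inP τ) ∧ τ ≤ᵇ σ) (K τ))
        ≈⟨ ∑-+ Πₙ _ _ ⟨
      ∑ Πₙ (λ τ → when (inP τ ∧ τ ≤ᵇ σ) (K τ) + when (not (inP τ) ∧ τ ≤ᵇ σ) (K τ))
        ≈⟨ ∑-cong Πₙ (λ {τ} _ → when-split (τ ≤ᵇ σ) (inP τ) (K τ)) ⟨
      ∑ Πₙ (λ τ → when (τ ≤ᵇ σ) (K τ))
        ≈⟨ ∑-cumulant f σ∈ ⟩
      f σ ∎)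
      where
      below-m : ∀ τ → when (τ ≤ᵇ m) (K τ) ≈ when (inP τ ∧ τ ≤ᵇ σ) (K τ)
      below-m τ = reflexive (≡.cong (λ b → when b (K τ))
        (det (reflects-map (Equivalence.to (m-meet τ)) (Equivalence.from (m-meet τ)) (≤ᵇ-reflects τ m))
             (proof (P? τ) ×-reflects ≤ᵇ-reflects τ σ)))

  ∑-allPartitions : (h : Vec ℕ n → Carrier) → ∑ (allPartitions n) (h ∘ labels) ≡ ∑ Πₙ h
  ∑-allPartitions h = ≡.cong (Σ[_] R) (≡.trans (map-mapWith∈ Πₙ (λ {v} v∈ → part v v∈) (h ∘ labels))
                                               (mapWith∈≗map h Πₙ))

-- Vanishing of mixed cumulants

record SeparatingColouring {n : ℕ} {p q : Level} (B : Fin n → Set p) (C : Fin n → Set q) (i j : Fin n)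
       : Set (p ⊔ q) where
  field
    colour   : Fin n → Bool
    colour⇒B : ∀ a → colour a ≡ true → B a
    colour⇒C : ∀ a → colour a ≡ false → C a
    colour-i : colour i ≡ true
    colour-j : colour j ≡ false

separatingColouring : {n : ℕ} {p q : Level} {B : Fin n → Set p} {C : Fin n → Set q} {i j : Fin n} →
                      (∀ a → B a ⊎ C a) → i ≢ j → B i → C j → SeparatingColouring B C i j
separatingColouring {B = B} {C} {i} {j} B∪C i≢j Bi Cj = record
  { colour = colour ; colour⇒B = colour⇒B ; colour⇒C = colour⇒C ; colour-i = colour-i ; colour-j = colour-j }
  where
  side : ∀ a → B a ⊎ C a
  side a with a Fin.≟ i | a Fin.≟ j
  ... | yes ≡.refl | _          = inj₁ Bi
  ... | no _       | yes ≡.refl = inj₂ Cj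
  ... | no _       | no _       = B∪C a
  colour : Fin _ → Bool
  colour a = [ (λ _ → true) , (λ _ → false) ]′ (side a)
  colour⇒B : ∀ a → colour a ≡ true → B a
  colour⇒B a with side a
  ... | inj₁ Ba = λ _ → Ba
  colour⇒C : ∀ a → colour a ≡ false → C a
  colour⇒C a with side a
  ... | inj₂ Ca = λ _ → Ca
  colour-i : colour i ≡ true
  colour-i with i Fin.≟ i
  ... | yes ≡.refl = ≡.refl
  ... | no i≢i     = ⊥-elim (i≢i ≡.refl)
  colour-j : colour j ≡ false
  colour-j with j Fin.≟ i | j Fin.≟ j
  ... | yes ≡.refl | _          = ⊥-elim (i≢j ≡.refl)
  ... | no _       | yes ≡.refl = ≡.refl
  ... | no _       | no j≢j     = ⊥-elim (j≢j ≡.refl)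

module _ {c ℓ a ℓa u ℓu : Level} {R : CommutativeRing c ℓ} {P : NCPS R a ℓa}
         (E : ExchangeabilitySystem P u ℓu) where
  open CommutativeRing R
  open ExchangeabilitySystem E using (𝒰; _⁽_⁾)
  open Möbius R
  open Sums R
  open SetoidReasoning setoid

  moment : {n : ℕ} → (Fin n → NCPS.Carrier P) → Vec ℕ n → Carrier
  moment X v = NCPS.φ 𝒰 (prod (NCPS.alg 𝒰) (λ m → X m ⁽ lookup v m ⁾))

  K≈cumulant : {n : ℕ} (π : Partition n) (X : Fin n → NCPS.Carrier P) →
               K[_] E π X ≈ cumulant n (moment X) (labels π)
  K≈cumulant {n} π X = begin
    K[_] E π X
      ≈⟨ ∑-filter (λ σ → labels σ ≤ᵇ labels π) (allPartitions n) _ ⟩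
    ∑ (allPartitions n) (λ σ → when (labels σ ≤ᵇ labels π) (φ[_] E σ X * μ R σ π))
      ≡⟨ ∑-allPartitions n (λ v → when (v ≤ᵇ labels π) (moment X v * μᵥ n v (labels π))) ⟩
    cumulant n (moment X) (labels π) ∎

  moment-meetSplit : {p q : Level} {B : NCPS.Carrier P → Set p} {C : NCPS.Carrier P → Set q} →
                     Independent E B C → {n : ℕ} (X : Fin n → NCPS.Carrier P) (s : Fin n → Bool) →
                     (∀ a → s a ≡ true → B (X a)) → (∀ a → s a ≡ false → C (X a)) →
                     ∀ {σ} → σ ∈ rgs n → moment X (meetSplit s σ) ≈ moment X σ
  moment-meetSplit independent {n} X s s⇒B s⇒C {σ} σ∈ =
    independent n X s s⇒B s⇒C (part (meetSplit s σ) (meetSplit∈ s σ)) (part σ σ∈) sameOn sameOn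
    where
    sameOn : ∀ {b} → SameOn E s b (part (meetSplit s σ) (meetSplit∈ s σ)) (part σ σ∈)
    sameOn i j si≡b sj≡b = meetSplit-agrees s σ i j (≡.trans si≡b (≡.sym sj≡b))

corollary2p9 : {c ℓ a ℓa u ℓu p q : Level} {R : CommutativeRing c ℓ} {P : NCPS R a ℓa}
    (E : ExchangeabilitySystem P u ℓu)
    (B : NCPS.Carrier P → Set p) (C : NCPS.Carrier P → Set q) →
    IsSubalgebra E B → IsSubalgebra E C → Independent E B C →
    (n : ℕ) (X : Fin n → NCPS.Carrier P) → (∀ i → B (X i) ⊎ C (X i)) →
    (π : Partition n) →
    Σ (Fin n) (λ i → Σ (Fin n) (λ j → i ≢ j × SameBlock π i j × B (X i) × C (X j))) →
    CommutativeRing._≈_ R (K[_] E π X) (CommutativeRing.0# R)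
corollary2p9 {R = R} E B C _ _ independent n X B∪C π (i , j , i≢j , πij , Bi , Cj) = begin
  K[_] E π X
    ≈⟨ K≈cumulant E π X ⟩
  cumulant n (moment E X) (labels π)
    ≈⟨ cumulant-vanishes n refinesColour? (moment E X) meet (canonical π) crosses ⟩
  0# ∎
  where
  open CommutativeRing R
  open Möbius R
  open SetoidReasoning setoid
  open SeparatingColouring (separatingColouring B∪C i≢j Bi Cj)
  refinesColour? : (τ : Vec ℕ n) → Dec (lookup τ ⊑ colour)
  refinesColour? τ = ⊑-dec ℕ._≟_ Bool._≟_ (lookup τ) colour
  meet : ∀ {σ} → σ ∈ rgs n →
         Σ (Vec ℕ n) λ m → m ∈ rgs n × MeetWith n (λ τ → lookup τ ⊑ colour) σ m × moment E X m ≈ moment E X σ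
  meet {σ} σ∈ = meetSplit colour σ , meetSplit∈ colour σ , meetSplit-meet colour σ ,
                moment-meetSplit E {B = B} {C} independent X colour colour⇒B colour⇒C σ∈
  crosses : ¬ lookup (labels π) ⊑ colour
  crosses π⊑colour with () ← ≡.trans (≡.sym colour-i) (≡.trans (π⊑colour i j πij) colour-j)
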